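{- Let $p$ be a positive integer and let $K_{p,p}$ be the complete bipartite graph with bipartition $(X,Y)$, where $X=\{x_{1},\ldots,x_{p}\}$ and $Y=\{y_{1},\ldots,y_{p}\}$. Then $K_{p,p}$ has an interval coloring $\beta$ such that $\min S(x_i,\beta)=\min S(y_i,\beta)=\left\lfloor \frac{i}{2}\right\rfloor+1$ for every $1\leq i\leq p$.
   Context: All graphs are finite, undirected, without loops or multiple edges. A proper $t$-edge-coloring of a graph $G$ is a map $\alpha:E(G)\to\{1,\ldots,t\}$ such that all $t$ colors are used and adjacent edges receive different colors. For a vertex $v$, the spectrum $S(v,\alpha)$ is the set of colors on edges incident to $v$. A proper $t$-edge-coloring is an interval $t$-coloring if $S(v,\alpha)$ is an interval of consecutive integers for every vertex $v$; an interval coloring is an interval $t$-coloring for some $t$. -}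

module Defs where

open import Data.Nat using (ℕ; suc; _≤_; _<_; _/_)
open import Data.Fin using (Fin; toℕ)
open import Data.Product using (Σ; ∃; _×_; _,_)
open import Relation.Binary.PropositionalEquality using (_≡_)
open import Function.Bundles using (_⇔_)

-- Vertex x_{i+1} is index i : Fin p on the X side, y_{j+1} is j : Fin p on
-- the Y side.
EdgeColouring : ℕ → Set
EdgeColouring p = Fin p → Fin p → ℕ

IsProperColouring : (p t : ℕ) → EdgeColouring p → Set
IsProperColouring p t β =
  (∀ i j → 1 ≤ β i j × β i j ≤ t)
  × (∀ c → 1 ≤ c → c ≤ t → ∃ λ i → ∃ λ j → β i j ≡ c)
  × (∀ i j k → β i j ≡ β i k → j ≡ k)
  × (∀ i j k → β i j ≡ β k j → i ≡ k)

InSpecX : {p : ℕ} → EdgeColouring p → Fin p → ℕ → Set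
InSpecX {p} β i c = ∃ λ (j : Fin p) → β i j ≡ c

InSpecY : {p : ℕ} → EdgeColouring p → Fin p → ℕ → Set
InSpecY {p} β j c = ∃ λ (i : Fin p) → β i j ≡ c

IsInterval : (ℕ → Set) → Set
IsInterval S = ∃ λ a → ∃ λ b → ∀ c → (S c ⇔ (a ≤ c × c ≤ b))

IsMin : (ℕ → Set) → ℕ → Set
IsMin S m = S m × (∀ c → S c → m ≤ c)

IsIntervalColouring : (p t : ℕ) → EdgeColouring p → Set
IsIntervalColouring p t β =
  IsProperColouring p t β
  × (∀ i → IsInterval (InSpecX β i))
  × (∀ j → IsInterval (InSpecY β j))

-- Index the vertices from 0, so x_i and y_i need spectrum minimum ⌈i/2⌉ + 1.
-- Row 2a+1 receives the colours a + 2, …, a + p + 1 in column order, and row 2a the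
-- colours a + 1, …, a + p read cyclically starting at column 2a. Every row is then an
-- injection of the p columns into (⌈i/2⌉, ⌈i/2⌉ + p], and a case analysis on parities
-- shows that column j is an injection of the p rows into (⌈j/2⌉, ⌈j/2⌉ + p]. By
-- pigeonhole such an injection is onto, so every spectrum is exactly that interval;
-- rows 0 and p − 1 together use every colour up to ⌈(p−1)/2⌉ + p.
module Submission where

open import Data.Empty using (⊥; ⊥-elim)
open import Data.Fin as Fin using (Fin; toℕ; fromℕ; fromℕ<; punchOut)
open import Data.Fin.Properties using (toℕ<n)
import Data.Fin.Properties as Finₚ
open import Data.Nat
open import Data.Nat.DivMod using (m/n≡1+[m∸n]/n)
open import Data.Nat.Properties
open import Data.Nat.Tactic.RingSolver using (solve-∀)
open import Data.Product using (∃; _×_; _,_; proj₁)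
open import Function.Base using (_∘_)
open import Function.Bundles using (_⇔_; mk⇔; Equivalence)
open import Relation.Binary.PropositionalEquality
open import Relation.Nullary using (yes; no; ¬_; contradiction)

open import Defs

injective⇒surjective : ∀ {n} (g : Fin n → Fin n) →
                       (∀ {x y} → g x ≡ g y → x ≡ y) → ∀ y → ∃ λ x → g x ≡ y
injective⇒surjective {suc n} g g-inj y with Finₚ.any? (λ x → g x Finₚ.≟ y)
... | yes hit = hit
... | no miss =
  let x , x' , x<x' , punched-equal = Finₚ.pigeonhole (n<1+n n) (λ x → punchOut (missed x))
  in contradiction (g-inj (Finₚ.punchOut-injective (missed x) (missed x') punched-equal))
                   (Finₚ.<⇒≢ x<x')
  where
  missed : ∀ x → y ≢ g x
  missed x y≡gx = miss (x , sym y≡gx)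

module _ {p a : ℕ} (f : Fin p → ℕ) (f-injective : ∀ {x y} → f x ≡ f y → x ≡ y)
         (f-bounded : ∀ x → a < f x × f x ≤ a + p) where

  private
    rank : ∀ c → a < c × c ≤ a + p → Fin p
    rank c (a<c , c≤a+p) =
      fromℕ< (subst (c ∸ suc a <_) (m+n∸m≡n (suc a) p) (∸-monoˡ-< (s≤s c≤a+p) a<c))

    rank-injective : ∀ {c c'} c∈ c'∈ → rank c c∈ ≡ rank c' c'∈ → c ≡ c'
    rank-injective (a<c , _) (a<c' , _) eq =
      ∸-cancelʳ-≡ a<c a<c'
        (trans (sym (Finₚ.toℕ-fromℕ< _)) (trans (cong toℕ eq) (Finₚ.toℕ-fromℕ< _)))

    rank∘f : Fin p → Fin p
    rank∘f x = rank (f x) (f-bounded x)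

  image-of-bounded-injection : ∀ c → (∃ λ x → f x ≡ c) ⇔ (a < c × c ≤ a + p)
  image-of-bounded-injection c = mk⇔ (λ { (x , refl) → f-bounded x }) λ c∈ →
    let x , eq = injective⇒surjective rank∘f
                   (λ {x} {y} → f-injective ∘ rank-injective (f-bounded x) (f-bounded y))
                   (rank c c∈)
    in x , rank-injective (f-bounded x) c∈ eq

interval⇒IsMin : ∀ {S : ℕ → Set} {a b} → a ≤ b → (∀ c → S c ⇔ (a ≤ c × c ≤ b)) → IsMin S a
interval⇒IsMin a≤b S⇔interval =
  Equivalence.from (S⇔interval _) (≤-refl , a≤b) , λ c Sc → proj₁ (Equivalence.to (S⇔interval c) Sc)

n/2≡⌊n/2⌋ : ∀ n → n / 2 ≡ ⌊ n /2⌋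
n/2≡⌊n/2⌋ 0 = refl
n/2≡⌊n/2⌋ 1 = refl
n/2≡⌊n/2⌋ (suc (suc n)) = trans (m/n≡1+[m∸n]/n {suc (suc n)} (s≤s (s≤s z≤n))) (cong suc (n/2≡⌊n/2⌋ n))

⌈n+n/2⌉≡n : ∀ n → ⌈ n + n /2⌉ ≡ n
⌈n+n/2⌉≡n zero = refl
⌈n+n/2⌉≡n (suc n) rewrite +-suc n n = cong suc (⌈n+n/2⌉≡n n)

m+m≤1+n+n⇒m≤n : ∀ {m n} → m + m ≤ suc (n + n) → m ≤ n
m+m≤1+n+n⇒m≤n {m} {n} le = subst₂ _≤_ (sym (n≡⌊n+n/2⌋ m)) (⌈n+n/2⌉≡n n) (⌊n/2⌋-mono le)

1+a+a<p⇒h+h<p⇒1+a+h<p : ∀ a h {p} → suc (a + a) < p → h + h < p → suc (a + h) < p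
1+a+a<p⇒h+h<p⇒1+a+h<p a h {p} 2a+1<p 2h<p =
  m+m≤1+n+n⇒m≤n (subst (_≤ suc (p + p)) (sym (double a h)) (s≤s (+-mono-≤ 2a+1<p 2h<p)))
  where
  double : ∀ a h → suc (suc (a + h)) + suc (suc (a + h)) ≡ suc (suc (suc (a + a)) + suc (h + h))
  double = solve-∀

data ParityView : ℕ → Set where
  even : ∀ a → ParityView (a + a)
  odd  : ∀ a → ParityView (suc (a + a))

parityView : ∀ n → ParityView n
parityView zero = even zero
parityView (suc zero) = odd zero
parityView (suc (suc n)) with parityView n
... | even a = subst ParityView (cong suc (+-suc a a)) (even (suc a))
... | odd a  = subst ParityView (cong (suc ∘ suc) (+-suc a a)) (odd (suc a))

half : ∀ {n} → ParityView n → ℕ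
half (even a) = a
half (odd a)  = a

ceil-half : ∀ {n} → ParityView n → ℕ
ceil-half (even a) = a
ceil-half (odd a)  = suc a

ceil-half≡⌈n/2⌉ : ∀ {n} (π : ParityView n) → ceil-half π ≡ ⌈ n /2⌉
ceil-half≡⌈n/2⌉ (even a) = sym (⌈n+n/2⌉≡n a)
ceil-half≡⌈n/2⌉ (odd a)  = cong suc (n≡⌊n+n/2⌋ a)

ceil-half+half≡n : ∀ {n} (π : ParityView n) → ceil-half π + half π ≡ n
ceil-half+half≡n (even a) = refl
ceil-half+half≡n (odd a)  = refl

ceil-half≤n : ∀ {n} (π : ParityView n) → ceil-half π ≤ n
ceil-half≤n π = subst (ceil-half π ≤_) (ceil-half+half≡n π) (m≤m+n _ _)

half+half≤n : ∀ {n} (π : ParityView n) → half π + half π ≤ n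
half+half≤n (even a) = ≤-refl
half+half≤n (odd a)  = n≤1+n _

m+m≤n⇒m≤half : ∀ {m n} (π : ParityView n) → m + m ≤ n → m ≤ half π
m+m≤n⇒m≤half (even a) le = m+m≤1+n+n⇒m≤n (m≤n⇒m≤1+n le)
m+m≤n⇒m≤half (odd a)  le = m+m≤1+n+n⇒m≤n le

n<m+m⇒half<m : ∀ {m n} (π : ParityView n) → n < m + m → half π < m
n<m+m⇒half<m π n<m+m =
  ≰⇒> λ m≤half → <⇒≱ n<m+m (≤-trans (+-mono-≤ m≤half m≤half) (half+half≤n π))

module Colouring (p : ℕ) where

  colour : ∀ {i} → ParityView i → ℕ → ℕ
  colour (odd a)  j = suc a + suc j
  colour (even a) j with a + a ≤? j
  ... | yes _ = suc j ∸ a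
  ... | no  _ = suc j + p ∸ a

  data EvenRowEntry (a j c : ℕ) : Set where
    from-diagonal : a + a ≤ j → c + a ≡ suc j     → EvenRowEntry a j c
    wrapped       : j < a + a → c + a ≡ suc j + p → EvenRowEntry a j c

  j<p⇒1+j≢1+k+p : ∀ {j k} → j < p → suc j ≢ suc k + p
  j<p⇒1+j≢1+k+p {j} {k} j<p = <⇒≢ (≤-<-trans j<p (m<n+m p z<s))

  wrap-clash : ∀ {a b j c} → b < p → c + a ≡ suc j → c + b ≡ suc j + p → ⊥
  wrap-clash {a} {b} {j} {c} b<p e e' = <⇒≱ b<p (begin
    p      ≤⟨ m≤n+m p a ⟩
    a + p  ≡⟨ +-cancelˡ-≡ c _ _ (begin-equality
      c + (a + p)  ≡⟨ +-assoc c a p ⟨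
      c + a + p    ≡⟨ cong (_+ p) e ⟩
      suc j + p    ≡⟨ e' ⟨
      c + b        ∎) ⟩
    b      ∎)
    where open ≤-Reasoning

  even-row-entry : ∀ a j → a + a < p → EvenRowEntry a j (colour (even a) j)
  even-row-entry a j 2a<p with a + a ≤? j
  ... | yes 2a≤j = from-diagonal 2a≤j (m∸n+n≡m (≤-trans (m≤m+n a a) (m≤n⇒m≤1+n 2a≤j)))
  ... | no  2a≰j = wrapped (≰⇒> 2a≰j)
                     (m∸n+n≡m (m≤n⇒m≤o+n (suc j) (≤-trans (m≤m+n a a) (<⇒≤ 2a<p))))

  even-row-bounds : ∀ {a j c} → a + a < p → j < p → EvenRowEntry a j c → a < c × c ≤ a + p
  even-row-bounds {a} {j} {c} _ j<p (from-diagonal 2a≤j c+a≡1+j) =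
    +-cancelʳ-< a a c (begin-strict
      a + a  ≤⟨ 2a≤j ⟩
      j      <⟨ n<1+n j ⟩
      suc j  ≡⟨ c+a≡1+j ⟨
      c + a  ∎) ,
    (begin
      c      ≤⟨ m≤m+n c a ⟩
      c + a  ≡⟨ c+a≡1+j ⟩
      suc j  ≤⟨ j<p ⟩
      p      ≤⟨ m≤n+m p a ⟩
      a + p  ∎)
    where open ≤-Reasoning
  even-row-bounds {a} {j} {c} 2a<p _ (wrapped j<2a c+a≡1+j+p) =
    +-cancelʳ-< a a c (begin-strict
      a + a      <⟨ 2a<p ⟩
      p          ≤⟨ m≤n+m p (suc j) ⟩
      suc j + p  ≡⟨ c+a≡1+j+p ⟨
      c + a      ∎) ,
    +-cancelʳ-≤ a c (a + p) (begin
      c + a      ≡⟨ c+a≡1+j+p ⟩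
      suc j + p  ≤⟨ +-monoˡ-≤ p j<2a ⟩
      a + a + p  ≡⟨ +-assoc a a p ⟩
      a + (a + p) ≡⟨ +-comm a (a + p) ⟩
      a + p + a  ∎)
    where open ≤-Reasoning

  row-bounds : ∀ {i} (π : ParityView i) j → i < p → j < p →
               ceil-half π < colour π j × colour π j ≤ ceil-half π + p
  row-bounds (odd a)  j _    j<p = m<m+n (suc a) z<s , +-monoʳ-≤ (suc a) j<p
  row-bounds (even a) j 2a<p j<p = even-row-bounds 2a<p j<p (even-row-entry a j 2a<p)

  even-row-injective : ∀ {a j k c} → j < p → k < p →
                       EvenRowEntry a j c → EvenRowEntry a k c → j ≡ k
  even-row-injective _ _ (from-diagonal _ e) (from-diagonal _ e') = suc-injective (trans (sym e) e')
  even-row-injective _ _ (wrapped _ e) (wrapped _ e') =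
    suc-injective (+-cancelʳ-≡ p _ _ (trans (sym e) e'))
  even-row-injective j<p _ (from-diagonal _ e) (wrapped _ e') =
    ⊥-elim (j<p⇒1+j≢1+k+p j<p (trans (sym e) e'))
  even-row-injective _ k<p (wrapped _ e) (from-diagonal _ e') =
    ⊥-elim (j<p⇒1+j≢1+k+p k<p (trans (sym e') e))

  row-injective : ∀ {i} (π : ParityView i) j k → i < p → j < p → k < p →
                  colour π j ≡ colour π k → j ≡ k
  row-injective (odd a)  _ _ _ _ _ eq = suc-injective (+-cancelˡ-≡ (suc a) _ _ eq)
  row-injective (even a) j k 2a<p j<p k<p eq =
    even-row-injective j<p k<p (subst (EvenRowEntry a j) eq (even-row-entry a j 2a<p))
                               (even-row-entry a k 2a<p)

  odd-row-column-bound : ∀ {a j} (ρ : ParityView j) → suc (a + a) < p → j < p →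
                         suc a + suc j ≤ ceil-half ρ + p
  odd-row-column-bound {a} {j} ρ 2a+1<p j<p = begin
    suc a + suc j                        ≡⟨ cong (λ n → suc a + suc n) (ceil-half+half≡n ρ) ⟨
    suc a + suc (ceil-half ρ + half ρ)   ≡⟨ shuffle a (ceil-half ρ) (half ρ) ⟩
    ceil-half ρ + suc (suc (a + half ρ)) ≤⟨ +-monoʳ-≤ (ceil-half ρ) 1+a+h<p ⟩
    ceil-half ρ + p                      ∎
    where
    open ≤-Reasoning
    shuffle : ∀ a m h → suc a + suc (m + h) ≡ m + suc (suc (a + h))
    shuffle = solve-∀
    1+a+h<p : suc (a + half ρ) < p
    1+a+h<p = 1+a+a<p⇒h+h<p⇒1+a+h<p a (half ρ) 2a+1<p (≤-<-trans (half+half≤n ρ) j<p)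

  even-row-column-bounds : ∀ {a j c} (ρ : ParityView j) → a + a < p → j < p → EvenRowEntry a j c →
                           ceil-half ρ < c × c ≤ ceil-half ρ + p
  even-row-column-bounds {a} {j} {c} ρ _ j<p (from-diagonal 2a≤j c+a≡1+j) =
    +-cancelʳ-< a (ceil-half ρ) c (begin-strict
      ceil-half ρ + a       ≤⟨ +-monoʳ-≤ (ceil-half ρ) (m+m≤n⇒m≤half ρ 2a≤j) ⟩
      ceil-half ρ + half ρ  ≡⟨ ceil-half+half≡n ρ ⟩
      j                     <⟨ n<1+n j ⟩
      suc j                 ≡⟨ c+a≡1+j ⟨
      c + a                 ∎) ,
    (begin
      c                ≤⟨ m≤m+n c a ⟩
      c + a            ≡⟨ c+a≡1+j ⟩
      suc j            ≤⟨ j<p ⟩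
      p                ≤⟨ m≤n+m p (ceil-half ρ) ⟩
      ceil-half ρ + p  ∎)
    where open ≤-Reasoning
  even-row-column-bounds {a} {j} {c} ρ 2a<p _ (wrapped j<2a c+a≡1+j+p) =
    +-cancelʳ-< a (ceil-half ρ) c (begin-strict
      ceil-half ρ + a  ≤⟨ +-mono-≤ (ceil-half≤n ρ) (≤-trans (m≤m+n a a) (<⇒≤ 2a<p)) ⟩
      j + p            <⟨ n<1+n (j + p) ⟩
      suc j + p        ≡⟨ c+a≡1+j+p ⟨
      c + a            ∎) ,
    +-cancelʳ-≤ a c (ceil-half ρ + p) (begin
      c + a                          ≡⟨ c+a≡1+j+p ⟩
      suc j + p                      ≡⟨ cong (λ n → suc n + p) (ceil-half+half≡n ρ) ⟨
      suc (ceil-half ρ + half ρ) + p ≤⟨ +-monoˡ-≤ p (+-monoʳ-< (ceil-half ρ) (n<m+m⇒half<m ρ j<2a)) ⟩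
      ceil-half ρ + a + p            ≡⟨ +-assoc (ceil-half ρ) a p ⟩
      ceil-half ρ + (a + p)          ≡⟨ cong (ceil-half ρ +_) (+-comm a p) ⟩
      ceil-half ρ + (p + a)          ≡⟨ +-assoc (ceil-half ρ) p a ⟨
      ceil-half ρ + p + a            ∎)
    where open ≤-Reasoning

  column-bounds : ∀ {i j} (π : ParityView i) (ρ : ParityView j) → i < p → j < p →
                  ceil-half ρ < colour π j × colour π j ≤ ceil-half ρ + p
  column-bounds {j = j} (odd a) ρ 2a+1<p j<p =
    ≤-<-trans (ceil-half≤n ρ) (m≤n+m (suc j) (suc a)) , odd-row-column-bound ρ 2a+1<p j<p
  column-bounds {j = j} (even a) ρ 2a<p j<p =
    even-row-column-bounds ρ 2a<p j<p (even-row-entry a j 2a<p)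

  odd-even-clash : ∀ {a b j} → suc (a + a) < p → b + b < p → ¬ EvenRowEntry b j (suc a + suc j)
  odd-even-clash {a} {b} {j} _ _ (from-diagonal _ e) =
    <⇒≢ (<-≤-trans (m<n+m (suc j) z<s) (m≤m+n (suc a + suc j) b)) (sym e)
  odd-even-clash {a} {b} {j} 2a+1<p 2b<p (wrapped _ e) =
    <⇒≢ (1+a+a<p⇒h+h<p⇒1+a+h<p a b 2a+1<p 2b<p) (+-cancelˡ-≡ (suc j) _ _ (trans (regroup a b j) e))
    where
    regroup : ∀ a b j → suc j + (suc a + b) ≡ suc a + suc j + b
    regroup = solve-∀

  even-column-injective : ∀ {a b j c} → a < p → b < p →
                          EvenRowEntry a j c → EvenRowEntry b j c → a ≡ b
  even-column-injective {c = c} _ _ (from-diagonal _ e) (from-diagonal _ e') =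
    +-cancelˡ-≡ c _ _ (trans e (sym e'))
  even-column-injective {c = c} _ _ (wrapped _ e) (wrapped _ e') =
    +-cancelˡ-≡ c _ _ (trans e (sym e'))
  even-column-injective _ b<p (from-diagonal _ e) (wrapped _ e') = ⊥-elim (wrap-clash b<p e e')
  even-column-injective a<p _ (wrapped _ e) (from-diagonal _ e') = ⊥-elim (wrap-clash a<p e' e)

  column-injective : ∀ {i k} (π : ParityView i) (π' : ParityView k) j → i < p → k < p →
                     colour π j ≡ colour π' j → i ≡ k
  column-injective (odd a) (odd b) j _ _ eq =
    cong (λ n → suc (n + n)) (suc-injective (+-cancelʳ-≡ (suc j) _ _ eq))
  column-injective (odd a) (even b) j 2a+1<p 2b<p eq =
    ⊥-elim (odd-even-clash 2a+1<p 2b<p (subst (EvenRowEntry b j) (sym eq) (even-row-entry b j 2b<p)))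
  column-injective (even a) (odd b) j 2a<p 2b+1<p eq =
    ⊥-elim (odd-even-clash 2b+1<p 2a<p (subst (EvenRowEntry a j) eq (even-row-entry a j 2a<p)))
  column-injective (even a) (even b) j 2a<p 2b<p eq =
    cong (λ n → n + n) (even-column-injective (half<p 2a<p) (half<p 2b<p)
      (subst (EvenRowEntry a j) eq (even-row-entry a j 2a<p)) (even-row-entry b j 2b<p))
    where
    half<p : ∀ {n} → n + n < p → n < p
    half<p {n} = ≤-<-trans (m≤m+n n n)

module Spectra (p : ℕ) where
  open Colouring p

  β : EdgeColouring p
  β x y = colour (parityView (toℕ x)) (toℕ y)

  β-row-injective : ∀ x y z → β x y ≡ β x z → y ≡ z
  β-row-injective x y z =
    Finₚ.toℕ-injective ∘ row-injective (parityView (toℕ x)) (toℕ y) (toℕ z)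
                                       (toℕ<n x) (toℕ<n y) (toℕ<n z)

  β-column-injective : ∀ x y x' → β x y ≡ β x' y → x ≡ x'
  β-column-injective x y x' =
    Finₚ.toℕ-injective ∘ column-injective (parityView (toℕ x)) (parityView (toℕ x')) (toℕ y)
                                          (toℕ<n x) (toℕ<n x')

  row-spectrum : ∀ x c → InSpecX β x c ⇔ (⌈ toℕ x /2⌉ < c × c ≤ ⌈ toℕ x /2⌉ + p)
  row-spectrum x = image-of-bounded-injection (β x) (λ {y} {z} → β-row-injective x y z) λ y →
    subst (λ m → m < β x y × β x y ≤ m + p) (ceil-half≡⌈n/2⌉ (parityView (toℕ x)))
          (row-bounds (parityView (toℕ x)) (toℕ y) (toℕ<n x) (toℕ<n y))

  column-spectrum : ∀ y c → InSpecY β y c ⇔ (⌈ toℕ y /2⌉ < c × c ≤ ⌈ toℕ y /2⌉ + p)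
  column-spectrum y =
    image-of-bounded-injection (λ x → β x y) (λ {x} {x'} → β-column-injective x y x') λ x →
      subst (λ m → m < β x y × β x y ≤ m + p) (ceil-half≡⌈n/2⌉ (parityView (toℕ y)))
            (column-bounds (parityView (toℕ x)) (parityView (toℕ y)) (toℕ<n x) (toℕ<n y))

β-proper : ∀ q → IsProperColouring (suc q) (⌈ q /2⌉ + suc q) (Spectra.β (suc q))
β-proper q = in-range , all-used , β-row-injective , β-column-injective
  where
  open Spectra (suc q)
  in-range : ∀ x y → 1 ≤ β x y × β x y ≤ ⌈ q /2⌉ + suc q
  in-range x y =
    let ⌈x/2⌉<c , c≤⌈x/2⌉+p = Equivalence.to (row-spectrum x (β x y)) (y , refl)
    in ≤-trans (s≤s z≤n) ⌈x/2⌉<c ,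
       ≤-trans c≤⌈x/2⌉+p (+-monoˡ-≤ (suc q) (⌈n/2⌉-mono (Finₚ.toℕ≤pred[n] x)))
  all-used : ∀ c → 1 ≤ c → c ≤ ⌈ q /2⌉ + suc q → ∃ λ x → ∃ λ y → β x y ≡ c
  all-used c 1≤c c≤t with c ≤? suc q
  ... | yes c≤p = Fin.zero , Equivalence.from (row-spectrum Fin.zero c) (1≤c , c≤p)
  ... | no  c≰p = fromℕ q , Equivalence.from (row-spectrum (fromℕ q) c)
                    (subst (λ m → m < c × c ≤ m + suc q) (cong ⌈_/2⌉ (sym (Finₚ.toℕ-fromℕ q)))
                           (<-trans (s≤s (⌈n/2⌉≤n q)) (≰⇒> c≰p) , c≤t))

lemma1 : (p : ℕ) → 1 ≤ p →
    ∃ λ (t : ℕ) → ∃ λ (β : EdgeColouring p) →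
      IsIntervalColouring p t β
      × (∀ (i : Fin p) →
           IsMin (InSpecX β i) (suc (toℕ i) / 2 + 1)
           × IsMin (InSpecY β i) (suc (toℕ i) / 2 + 1))
lemma1 (suc q) _ =
  ⌈ q /2⌉ + suc q , β ,
  (β-proper q , (λ x → _ , _ , row-spectrum x) , (λ y → _ , _ , column-spectrum y)) ,
  λ i → minimum i (row-spectrum i) , minimum i (column-spectrum i)
  where
  open Spectra (suc q)
  minimum : ∀ i {S : ℕ → Set} → (∀ c → S c ⇔ (⌈ toℕ i /2⌉ < c × c ≤ ⌈ toℕ i /2⌉ + suc q)) →
            IsMin S (suc (toℕ i) / 2 + 1)
  minimum i S⇔interval =
    subst (IsMin _) (trans (cong suc (sym (n/2≡⌊n/2⌋ (suc (toℕ i))))) (+-comm 1 _))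
          (interval⇒IsMin (m<m+n _ z<s) S⇔interval)
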